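{- For every integer $p\ge1$, $$G^{(p)}(t,u,v,z,x)=\frac{1}{1-tz}+\frac{x}{1-tzx}\,G^{(p)}_1(t,u,v,z).$$
   Context: For a finite integer sequence $(a_1,\dots,a_i)$, $\mathrm{asc}(a_1,\dots,a_i)=|\{j:1\le j<i,\ a_j<a_{j+1}\}|$. For an integer $p\ge1$, a $p$-ascent sequence of length $n\ge1$ is a sequence $(a_1,\dots,a_n)$ of nonnegative integers with $a_1=0$ and $a_i\le p+\mathrm{asc}(a_1,\dots,a_{i-1})$ for all $2\le i\le n$; the empty word is also a $p$-ascent sequence. Let $Asc(p)$ be the set of $p$-ascent sequences. For a sequence $w$, $|w|$ is its length, $\mathrm{asc}(w)$ its number of ascents, $\mathrm{last}(w)$ its last letter, $|w|_0$ its number of zeros, and $\mathrm{run}(w)=0$ if $w=0^n$ for some $n\ge0$, while $\mathrm{run}(w)=r$ if $w=0^r y v$ with $y$ a positive integer and $v$ a word. Define $G^{(p)}(t,u,v,z,x)=\sum_{w\in Asc(p)}t^{|w|}u^{\mathrm{asc}(w)}v^{\mathrm{last}(w)}z^{|w|_0}x^{\mathrm{run}(w)}$ (the empty word contributes $1$), and $G^{(p)}_1(t,u,v,z)=\sum_w t^{|w|}u^{\mathrm{asc}(w)}v^{\mathrm{last}(w)}z^{|w|_0}$ summed over $p$-ascent sequences $w$ beginning with exactly one zero followed by a nonzero letter. -}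

module Defs where

open import Data.Nat using (ℕ; zero; suc; _+_; _*_; _∸_; _<ᵇ_; _≡ᵇ_; _≤ᵇ_)
open import Data.Bool using (Bool; true; false; _∧_; not; if_then_else_)
open import Data.List using (List; []; _∷_; reverse; map; concatMap; length; filterᵇ; upTo)

asc : List ℕ → ℕ
asc [] = 0
asc (x ∷ []) = 0
asc (x ∷ y ∷ r) = (if x <ᵇ y then 1 else 0) + asc (y ∷ r)

-- last letter (the empty word gets 0, so it contributes v^0)
lastL : List ℕ → ℕ
lastL [] = 0
lastL (x ∷ []) = x
lastL (x ∷ y ∷ r) = lastL (y ∷ r)

zeros : List ℕ → ℕ
zeros [] = 0
zeros (x ∷ r) = (if x ≡ᵇ 0 then 1 else 0) + zeros r

-- run(w): 0 if w = 0^n, otherwise r where w = 0^r y v with y > 0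
allZero : List ℕ → Bool
allZero [] = true
allZero (a ∷ s) = (a ≡ᵇ 0) ∧ allZero s

run : List ℕ → ℕ
run [] = 0
run (zero ∷ r) = if allZero r then 0 else suc (run r)
run (suc _ ∷ r) = 0

-- validRev p (a_n ∷ ... ∷ a_1) checks a_1 = 0 and
-- a_i ≤ p + asc(a_1 ... a_{i-1}) for 2 ≤ i ≤ n.
validRev : ℕ → List ℕ → Bool
validRev p [] = true
validRev p (a ∷ []) = a ≡ᵇ 0
validRev p (a ∷ b ∷ r) = validRev p (b ∷ r) ∧ (a ≤ᵇ p + asc (reverse (b ∷ r)))

isPAscent : ℕ → List ℕ → Bool
isPAscent p w = validRev p (reverse w)

words : ℕ → ℕ → List (List ℕ)
words zero m = [] ∷ []
words (suc n) m = concatMap (λ a → map (a ∷_) (words n m)) (upTo m)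

-- p-ascent sequences of length n (every letter is ≤ p + asc ≤ p + n, so
-- letters < p + n + 1 suffice)
pAscOfLength : ℕ → ℕ → List (List ℕ)
pAscOfLength p n = filterᵇ (isPAscent p) (words n (suc (p + n)))

-- Formal power series in t,u,v,z,x with ℕ coefficients:
-- f n a b c r = coefficient of t^n u^a v^b z^c x^r

Series : Set
Series = ℕ → ℕ → ℕ → ℕ → ℕ → ℕ

sumTo : ℕ → (ℕ → ℕ) → ℕ
sumTo zero f = f 0
sumTo (suc n) f = sumTo n f + f (suc n)

count : {A : Set} → (A → Bool) → List A → ℕ
count P xs = length (filterᵇ P xs)

_⊕_ : Series → Series → Series
(f ⊕ g) n a b c r = f n a b c r + g n a b c r

_⊗_ : Series → Series → Series
(f ⊗ g) n a b c r =
  sumTo n λ i → sumTo a λ j → sumTo b λ k → sumTo c λ l → sumTo r λ m →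
    f i j k l m * g (n ∸ i) (a ∸ j) (b ∸ k) (c ∸ l) (r ∸ m)

infixl 6 _⊕_
infixl 7 _⊗_

record Mono : Set where
  constructor mono
  field e1 e2 e3 e4 e5 : ℕ

monoS : Mono → Series
monoS (mono e1 e2 e3 e4 e5) n a b c r =
  if (n ≡ᵇ e1) ∧ (a ≡ᵇ e2) ∧ (b ≡ᵇ e3) ∧ (c ≡ᵇ e4) ∧ (r ≡ᵇ e5) then 1 else 0

-- geometric series 1/(1 - m) = Σ_{k≥0} m^k for a nonconstant monomial m
-- (coefficient = number of k with k·e = exponent; k is bounded by the
-- total degree)
geomS : Mono → Series
geomS (mono e1 e2 e3 e4 e5) n a b c r =
  count (λ k → (n ≡ᵇ k * e1) ∧ (a ≡ᵇ k * e2) ∧ (b ≡ᵇ k * e3)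
                 ∧ (c ≡ᵇ k * e4) ∧ (r ≡ᵇ k * e5))
        (upTo (suc (n + a + b + c + r)))

G : ℕ → Series
G p n a b c r =
  count (λ w → (asc w ≡ᵇ a) ∧ (lastL w ≡ᵇ b) ∧ (zeros w ≡ᵇ c) ∧ (run w ≡ᵇ r))
        (pAscOfLength p n)

startsOneZero : List ℕ → Bool
startsOneZero (zero ∷ suc _ ∷ _) = true
startsOneZero _ = false

-- G^(p)_1(t,u,v,z), viewed as a series in t,u,v,z,x (no x)
G1 : ℕ → Series
G1 p n a b c r =
  if r ≡ᵇ 0
  then count (λ w → startsOneZero w ∧ (asc w ≡ᵇ a) ∧ (lastL w ≡ᵇ b) ∧ (zeros w ≡ᵇ c))
             (pAscOfLength p n)
  else 0

tz x tzx : Mono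
tz = mono 1 0 0 1 0
x = mono 0 0 0 0 1
tzx = mono 1 0 0 1 1

-- Every p-ascent sequence starts with 0, so a sequence w has run(w) = 0 exactly when
-- w = 0^n, which gives the term 1/(1 - tz).  If run(w) = s + 1, deleting the first s
-- zeros changes neither the ascents nor the last letter, and it keeps the p-ascent
-- condition because zeros create no ascents; this is a bijection onto the sequences
-- with run 1, i.e. those counted by G₁, and it lowers the length and the number of
-- zeros by s.  Summing over s gives x/(1 - tzx) · G₁.
-- Formally the zeros are deleted one at a time from the left, which needs the p-ascent
-- condition in left-to-right form, and since the sequences of length n are enumerated
-- over the alphabet {0,…,p+n}, also that any alphabet {0,…,N} with N ≥ p + n yields
-- the same count.
module Submission where

open import Defs
open import Data.Bool using (Bool; true; false; _∧_; if_then_else_; T)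
open import Data.Bool.Properties using (∧-assoc; ∧-identityʳ; ∧-zeroʳ)
open import Data.Bool.Solver using (module ∨-∧-Solver)
open import Data.Empty using (⊥; ⊥-elim)
open import Data.List
  using (List; []; _∷_; _++_; [_]; map; concatMap; filterᵇ; applyUpTo; reverse)
open import Data.List.Properties using (unfold-reverse; reverse-involutive)
open import Data.Nat
  using (ℕ; zero; suc; _+_; _*_; _∸_; _≡ᵇ_; _≤ᵇ_; _<ᵇ_; _≤_; _<_; z≤n; s≤s)
open import Data.Nat.Properties
open import Data.Product using (_×_; _,_; proj₁; proj₂)
open import Data.Sum using (inj₁; inj₂)
open import Function using (_$_; _∘_; case_of_)
open import Relation.Nullary using (¬_)
open import Relation.Nullary.Decidable using (decidable-stable)
open import Relation.Nullary.Reflects using (ofʸ; ofⁿ)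
open import Relation.Binary.PropositionalEquality hiding ([_])

toℕ : Bool → ℕ
toℕ b = if b then 1 else 0

toℕ≤1 : ∀ b → toℕ b ≤ 1
toℕ≤1 true  = ≤-refl
toℕ≤1 false = z≤n

≡ᵇ-refl : ∀ n → (n ≡ᵇ n) ≡ true
≡ᵇ-refl zero    = refl
≡ᵇ-refl (suc n) = ≡ᵇ-refl n

≡ᵇ-comm : ∀ m n → (m ≡ᵇ n) ≡ (n ≡ᵇ m)
≡ᵇ-comm zero    zero    = refl
≡ᵇ-comm zero    (suc n) = refl
≡ᵇ-comm (suc m) zero    = refl
≡ᵇ-comm (suc m) (suc n) = ≡ᵇ-comm m n

≡ᵇ≡true⇒≡ : ∀ m n → (m ≡ᵇ n) ≡ true → m ≡ n
≡ᵇ≡true⇒≡ m n eq = ≡ᵇ⇒≡ m n (subst T (sym eq) _)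

≢⇒≡ᵇ-false : ∀ {m n} → m ≢ n → (m ≡ᵇ n) ≡ false
≢⇒≡ᵇ-false {m} {n} m≢n with m ≡ᵇ n in eq
... | true  = ⊥-elim (m≢n (≡ᵇ≡true⇒≡ m n eq))
... | false = refl

≤ᵇ-suc : ∀ m n → (suc m ≤ᵇ suc n) ≡ (m ≤ᵇ n)
≤ᵇ-suc zero    n = refl
≤ᵇ-suc (suc m) n = refl

m*n≢0⇒m≢0×n≢0 : ∀ m n → m * n ≢ 0 → m ≢ 0 × n ≢ 0
m*n≢0⇒m≢0×n≢0 m n mn≢0 = (λ { refl → mn≢0 refl }) , (λ { refl → mn≢0 (*-zeroʳ m) })

module _ where
  open ∨-∧-Solver

  ∧-rotate : ∀ u v w → u ∧ v ∧ w ≡ w ∧ u ∧ v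
  ∧-rotate = solve 3 (λ u v w → u :* (v :* w) := w :* (u :* v)) refl

  ∧-shuffle₅ : ∀ v a b c r → v ∧ a ∧ b ∧ c ∧ r ≡ r ∧ v ∧ c ∧ a ∧ b
  ∧-shuffle₅ = solve 5
    (λ v a b c r → v :* (a :* (b :* (c :* r))) := r :* (v :* (c :* (a :* b)))) refl

  ∧-shuffle₅′ : ∀ s v c a b → s ∧ v ∧ c ∧ a ∧ b ≡ v ∧ s ∧ a ∧ b ∧ c
  ∧-shuffle₅′ = solve 5
    (λ s v c a b → s :* (v :* (c :* (a :* b))) := v :* (s :* (a :* (b :* c)))) refl

module _ {A : Set} where

  count-cons : ∀ (P : A → Bool) y ys → count P (y ∷ ys) ≡ toℕ (P y) + count P ys
  count-cons P y ys with P y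
  ... | true  = refl
  ... | false = refl

  count-singleton : ∀ (P : A → Bool) y → count P [ y ] ≡ toℕ (P y)
  count-singleton P y = trans (count-cons P y []) (+-identityʳ _)

  count-++ : ∀ (P : A → Bool) xs ys → count P (xs ++ ys) ≡ count P xs + count P ys
  count-++ P []       ys = refl
  count-++ P (y ∷ xs) ys = begin
    count P (y ∷ xs ++ ys)                ≡⟨ count-cons P y (xs ++ ys) ⟩
    toℕ (P y) + count P (xs ++ ys)        ≡⟨ cong (toℕ (P y) +_) (count-++ P xs ys) ⟩
    toℕ (P y) + (count P xs + count P ys) ≡⟨ +-assoc (toℕ (P y)) _ _ ⟨
    toℕ (P y) + count P xs + count P ys   ≡⟨ cong (_+ count P ys) (count-cons P y xs) ⟨
    count P (y ∷ xs) + count P ys         ∎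
    where open ≡-Reasoning

  count-cong : ∀ {P Q : A → Bool} xs → (∀ w → P w ≡ Q w) → count P xs ≡ count Q xs
  count-cong {P} {Q} []       P≗Q = refl
  count-cong {P} {Q} (y ∷ xs) P≗Q rewrite count-cons P y xs | count-cons Q y xs | P≗Q y =
    cong (toℕ (Q y) +_) (count-cong xs P≗Q)

  count-zero : ∀ {P : A → Bool} xs → (∀ w → P w ≡ false) → count P xs ≡ 0
  count-zero {P} []       P≗false = refl
  count-zero {P} (y ∷ xs) P≗false rewrite count-cons P y xs | P≗false y =
    count-zero xs P≗false

  count-filterᵇ : ∀ (P Q : A → Bool) xs →
    count P (filterᵇ Q xs) ≡ count (λ w → Q w ∧ P w) xs
  count-filterᵇ P Q []       = refl
  count-filterᵇ P Q (y ∷ xs) rewrite count-cons (λ w → Q w ∧ P w) y xs with Q y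
  ... | false = count-filterᵇ P Q xs
  ... | true  =
    trans (count-cons P y (filterᵇ Q xs)) (cong (toℕ (P y) +_) (count-filterᵇ P Q xs))

count-map : ∀ {A B : Set} (P : B → Bool) (f : A → B) xs →
  count P (map f xs) ≡ count (λ y → P (f y)) xs
count-map P f []       = refl
count-map P f (y ∷ xs) rewrite count-cons P (f y) (map f xs) | count-cons (λ y → P (f y)) y xs
  = cong (toℕ (P (f y)) +_) (count-map P f xs)

sumTo-suc : ∀ N f → sumTo (suc N) f ≡ f 0 + sumTo N (λ i → f (suc i))
sumTo-suc zero    f = refl
sumTo-suc (suc N) f rewrite sumTo-suc N f = +-assoc (f 0) _ _

sumTo-cong : ∀ {N f g} → (∀ i → i ≤ N → f i ≡ g i) → sumTo N f ≡ sumTo N g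
sumTo-cong {zero}  f≗g = f≗g 0 z≤n
sumTo-cong {suc N} f≗g =
  cong₂ _+_ (sumTo-cong λ i i≤N → f≗g i (m≤n⇒m≤1+n i≤N)) (f≗g (suc N) ≤-refl)

sumTo-zero : ∀ {N f} → (∀ i → i ≤ N → f i ≡ 0) → sumTo N f ≡ 0
sumTo-zero {zero}  f≗0 = f≗0 0 z≤n
sumTo-zero {suc N} f≗0 =
  cong₂ _+_ (sumTo-zero λ i i≤N → f≗0 i (m≤n⇒m≤1+n i≤N)) (f≗0 (suc N) ≤-refl)

sumTo-single : ∀ {N f j} → j ≤ N → (∀ i → i ≤ N → i ≢ j → f i ≡ 0) → sumTo N f ≡ f j
sumTo-single {zero} z≤n off = refl
sumTo-single {suc N} {f} j≤1+N off with m≤n⇒m<n∨m≡n j≤1+N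
... | inj₂ refl =
  cong (_+ f (suc N)) (sumTo-zero λ i i≤N → off i (m≤n⇒m≤1+n i≤N) (<⇒≢ (s≤s i≤N)))
... | inj₁ j<1+N = trans
  (cong₂ _+_ (sumTo-single (≤-pred j<1+N) λ i i≤N → off i (m≤n⇒m≤1+n i≤N))
             (off (suc N) ≤-refl (>⇒≢ j<1+N)))
  (+-identityʳ _)

sumTo-trunc : ∀ {L N f} → L ≤ N → (∀ i → L < i → i ≤ N → f i ≡ 0) → sumTo N f ≡ sumTo L f
sumTo-trunc {N = zero}  z≤n   _   = refl
sumTo-trunc {N = suc N} L≤1+N off with m≤n⇒m<n∨m≡n L≤1+N
... | inj₂ refl = refl
... | inj₁ L<1+N = trans
  (cong₂ _+_ (sumTo-trunc (≤-pred L<1+N) λ i L<i i≤N → off i L<i (m≤n⇒m≤1+n i≤N))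
             (off (suc N) L<1+N ≤-refl))
  (+-identityʳ _)

count-applyUpTo : ∀ (P : ℕ → Bool) g N →
  count P (applyUpTo g (suc N)) ≡ sumTo N (λ k → toℕ (P (g k)))
count-applyUpTo P g zero    = count-singleton P (g 0)
count-applyUpTo P g (suc N) = begin
  count P (applyUpTo g (2 + N))
    ≡⟨ count-cons P (g 0) _ ⟩
  toℕ (P (g 0)) + count P (applyUpTo (λ k → g (suc k)) (suc N))
    ≡⟨ cong (toℕ (P (g 0)) +_) (count-applyUpTo P _ N) ⟩
  toℕ (P (g 0)) + sumTo N (λ k → toℕ (P (g (suc k))))
    ≡⟨ sumTo-suc N _ ⟨
  sumTo (suc N) (λ k → toℕ (P (g k)))
    ∎
  where open ≡-Reasoning

count-concatMap-applyUpTo : ∀ {A : Set} (P : A → Bool) (f : ℕ → List A) g N →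
  count P (concatMap f (applyUpTo g (suc N))) ≡ sumTo N (λ k → count P (f (g k)))
count-concatMap-applyUpTo P f g zero    = trans (count-++ P (f (g 0)) []) (+-identityʳ _)
count-concatMap-applyUpTo P f g (suc N) = begin
  count P (concatMap f (applyUpTo g (2 + N)))
    ≡⟨ count-++ P (f (g 0)) _ ⟩
  count P (f (g 0)) + count P (concatMap f (applyUpTo (λ k → g (suc k)) (suc N)))
    ≡⟨ cong (count P (f (g 0)) +_) (count-concatMap-applyUpTo P f _ N) ⟩
  count P (f (g 0)) + sumTo N (λ k → count P (f (g (suc k))))
    ≡⟨ sumTo-suc N _ ⟨
  sumTo (suc N) (λ k → count P (f (g k)))
    ∎
  where open ≡-Reasoning

count-words-suc : ∀ P n N →
  count P (words (suc n) (suc N)) ≡ sumTo N (λ y → count (λ w → P (y ∷ w)) (words n (suc N)))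
count-words-suc P n N =
  trans (count-concatMap-applyUpTo P (λ y → map (y ∷_) (words n (suc N))) (λ y → y) N)
        (sumTo-cong {N} λ y _ → count-map P (y ∷_) (words n (suc N)))

count-words-suc-0∷ : ∀ P n N → (∀ y w → P (suc y ∷ w) ≡ false) →
  count P (words (suc n) (suc N)) ≡ count (λ w → P (0 ∷ w)) (words n (suc N))
count-words-suc-0∷ P n N P-suc∷≡false = trans (count-words-suc P n N) (sumTo-single z≤n off)
  where
  off : ∀ y → y ≤ N → y ≢ 0 → count (λ w → P (y ∷ w)) (words n (suc N)) ≡ 0
  off zero    _ y≢0 = ⊥-elim (y≢0 refl)
  off (suc y) _ _   = count-zero (words n (suc N)) (P-suc∷≡false y)

_at_ : Series → Mono → ℕ
f at mono n a b c r = f n a b c r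

_≼_ : Mono → Mono → Set
mono i j k l m ≼ mono n a b c r = i ≤ n × j ≤ a × k ≤ b × l ≤ c × m ≤ r

boxSum : Mono → Series → ℕ
boxSum (mono n a b c r) F =
  sumTo n λ i → sumTo a λ j → sumTo b λ k → sumTo c λ l → sumTo r λ m → F i j k l m

convolutionTerm : Series → Series → Mono → Series
convolutionTerm f g (mono n a b c r) i j k l m =
  f i j k l m * g (n ∸ i) (a ∸ j) (b ∸ k) (c ∸ l) (r ∸ m)

boxSum-zero : ∀ N F → (∀ q → q ≼ N → F at q ≢ 0 → ⊥) → boxSum N F ≡ 0
boxSum-zero (mono n a b c r) F no-support =
  sumTo-zero λ i i≤ → sumTo-zero λ j j≤ → sumTo-zero λ k k≤ → sumTo-zero λ l l≤ →
    sumTo-zero λ m m≤ →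
      decidable-stable (_ ≟ 0) (no-support (mono i j k l m) (i≤ , j≤ , k≤ , l≤ , m≤))

boxSum-single : ∀ N F q₀ → q₀ ≼ N → (∀ q → q ≼ N → F at q ≢ 0 → q ≡ q₀) →
  boxSum N F ≡ F at q₀
boxSum-single (mono n a b c r) F (mono i₀ j₀ k₀ l₀ m₀) (i₀≤ , j₀≤ , k₀≤ , l₀≤ , m₀≤) support =
  trans (sumTo-single i₀≤ λ i i≤ i≢ →
           sumTo-zero λ j j≤ → sumTo-zero λ k k≤ → sumTo-zero λ l l≤ → sumTo-zero λ m m≤ →
             off (i≤ , j≤ , k≤ , l≤ , m≤) λ { refl → i≢ refl }) $
  trans (sumTo-single j₀≤ λ j j≤ j≢ →
           sumTo-zero λ k k≤ → sumTo-zero λ l l≤ → sumTo-zero λ m m≤ →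
             off (i₀≤ , j≤ , k≤ , l≤ , m≤) λ { refl → j≢ refl }) $
  trans (sumTo-single k₀≤ λ k k≤ k≢ →
           sumTo-zero λ l l≤ → sumTo-zero λ m m≤ →
             off (i₀≤ , j₀≤ , k≤ , l≤ , m≤) λ { refl → k≢ refl }) $
  trans (sumTo-single l₀≤ λ l l≤ l≢ →
           sumTo-zero λ m m≤ →
             off (i₀≤ , j₀≤ , k₀≤ , l≤ , m≤) λ { refl → l≢ refl }) $
  sumTo-single m₀≤ λ m m≤ m≢ →
             off (i₀≤ , j₀≤ , k₀≤ , l₀≤ , m≤) λ { refl → m≢ refl }
  where
  off : ∀ {i j k l m} → mono i j k l m ≼ mono n a b c r →
        mono i j k l m ≢ mono i₀ j₀ k₀ l₀ m₀ → F i j k l m ≡ 0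
  off q≼N q≢q₀ = decidable-stable (_ ≟ 0) λ Fq≢0 → q≢q₀ (support _ q≼N Fq≢0)

boxSum-outside : ∀ N F q₀ → ¬ q₀ ≼ N → (∀ q → q ≼ N → F at q ≢ 0 → q ≡ q₀) →
  boxSum N F ≡ 0
boxSum-outside N F q₀ q₀⋠N support =
  boxSum-zero N F λ q q≼N Fq≢0 → q₀⋠N (subst (_≼ N) (support q q≼N Fq≢0) q≼N)

monoS-support : ∀ e q → monoS e at q ≢ 0 → q ≡ e
monoS-support (mono e₁ e₂ e₃ e₄ e₅) (mono i j k l m) nonzero
  with i ≡ᵇ e₁ in i≡ | j ≡ᵇ e₂ in j≡ | k ≡ᵇ e₃ in k≡ | l ≡ᵇ e₄ in l≡ | m ≡ᵇ e₅ in m≡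
... | true  | true  | true  | true  | true
  rewrite ≡ᵇ≡true⇒≡ i e₁ i≡ | ≡ᵇ≡true⇒≡ j e₂ j≡ | ≡ᵇ≡true⇒≡ k e₃ k≡
        | ≡ᵇ≡true⇒≡ l e₄ l≡ | ≡ᵇ≡true⇒≡ m e₅ m≡ = refl
... | false | _     | _     | _     | _     = ⊥-elim (nonzero refl)
... | true  | false | _     | _     | _     = ⊥-elim (nonzero refl)
... | true  | true  | false | _     | _     = ⊥-elim (nonzero refl)
... | true  | true  | true  | false | _     = ⊥-elim (nonzero refl)
... | true  | true  | true  | true  | false = ⊥-elim (nonzero refl)

monoS-vanishes : ∀ e q → q ≢ e → monoS e at q ≡ 0
monoS-vanishes e q q≢e = decidable-stable (_ ≟ 0) λ nonzero → q≢e (monoS-support e q nonzero)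

monoS-at-self : ∀ e → monoS e at e ≡ 1
monoS-at-self (mono e₁ e₂ e₃ e₄ e₅)
  rewrite ≡ᵇ-refl e₁ | ≡ᵇ-refl e₂ | ≡ᵇ-refl e₃ | ≡ᵇ-refl e₄ | ≡ᵇ-refl e₅ = refl

geomS-t-linear : ∀ e₂ e₃ e₄ e₅ n a b c r →
  geomS (mono 1 e₂ e₃ e₄ e₅) n a b c r ≡
  monoS (mono n (n * e₂) (n * e₃) (n * e₄) (n * e₅)) n a b c r
geomS-t-linear e₂ e₃ e₄ e₅ n a b c r = begin
  count P (applyUpTo (λ k → k) (suc (n + a + b + c + r))) ≡⟨ count-applyUpTo P (λ k → k) _ ⟩
  sumTo (n + a + b + c + r) (λ k → toℕ (P k))             ≡⟨ sumTo-single n≤ off ⟩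
  toℕ ((n ≡ᵇ n * 1) ∧ rest n)
    ≡⟨ cong (λ t → toℕ ((n ≡ᵇ t) ∧ rest n)) (*-identityʳ n) ⟩
  toℕ ((n ≡ᵇ n) ∧ rest n)                                  ∎
  where
  open ≡-Reasoning
  rest : ℕ → Bool
  rest k = (a ≡ᵇ k * e₂) ∧ (b ≡ᵇ k * e₃) ∧ (c ≡ᵇ k * e₄) ∧ (r ≡ᵇ k * e₅)
  P : ℕ → Bool
  P k = (n ≡ᵇ k * 1) ∧ rest k
  n≤ : n ≤ n + a + b + c + r
  n≤ = m≤n⇒m≤n+o r (m≤n⇒m≤n+o c (m≤n⇒m≤n+o b (m≤m+n n a)))
  off : ∀ k → k ≤ n + a + b + c + r → k ≢ n → toℕ (P k) ≡ 0
  off k _ k≢n rewrite *-identityʳ k | ≢⇒≡ᵇ-false (k≢n ∘ sym) = refl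

geomS-tz : ∀ n a b c r → geomS tz n a b c r ≡ monoS (mono n 0 0 n 0) n a b c r
geomS-tz n a b c r =
  trans (geomS-t-linear 0 0 1 0 n a b c r) (cong (λ e → monoS e n a b c r) exponents)
  where
  exponents : mono n (n * 0) (n * 0) (n * 1) (n * 0) ≡ mono n 0 0 n 0
  exponents rewrite *-zeroʳ n | *-identityʳ n = refl

geomS-tzx : ∀ n a b c r → geomS tzx n a b c r ≡ monoS (mono n 0 0 n n) n a b c r
geomS-tzx n a b c r =
  trans (geomS-t-linear 0 0 1 1 n a b c r) (cong (λ e → monoS e n a b c r) exponents)
  where
  exponents : mono n (n * 0) (n * 0) (n * 1) (n * 1) ≡ mono n 0 0 n n
  exponents rewrite *-zeroʳ n | *-identityʳ n = refl

geomS-tz-x⁰ : ∀ n a b c → geomS tz n a b c 0 ≡ toℕ ((n ≡ᵇ c) ∧ (0 ≡ᵇ a) ∧ (0 ≡ᵇ b))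
geomS-tz-x⁰ n a b c
  rewrite geomS-tz n a b c 0 | ≡ᵇ-refl n | ∧-identityʳ (c ≡ᵇ n)
        | ≡ᵇ-comm a 0 | ≡ᵇ-comm b 0 | ≡ᵇ-comm c n
  = cong toℕ (∧-rotate (0 ≡ᵇ a) (0 ≡ᵇ b) (n ≡ᵇ c))

geomS-tz-x^suc : ∀ n a b c s → geomS tz n a b c (suc s) ≡ 0
geomS-tz-x^suc n a b c s =
  trans (geomS-tz n a b c (suc s)) (monoS-vanishes (mono n 0 0 n 0) (mono n a b c (suc s)) λ ())

xShift : Series → Series
xShift f n a b c zero    = 0
xShift f n a b c (suc r) = f n a b c r

x⊗-support : ∀ f N q → q ≼ N → convolutionTerm (monoS x) f N at q ≢ 0 → q ≡ x
x⊗-support f (mono n a b c r) (mono i j k l m) _ nonzero =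
  monoS-support x (mono i j k l m) (proj₁ (m*n≢0⇒m≢0×n≢0 _ _ nonzero))

x⊗≡xShift : ∀ f n a b c r → (monoS x ⊗ f) n a b c r ≡ xShift f n a b c r
x⊗≡xShift f n a b c zero =
  boxSum-outside _ (convolutionTerm (monoS x) f (mono n a b c 0)) x (λ { (_ , _ , _ , _ , ()) })
                 (x⊗-support f _)
x⊗≡xShift f n a b c (suc s) =
  trans (boxSum-single _ (convolutionTerm (monoS x) f (mono n a b c (suc s))) x
                       (z≤n , z≤n , z≤n , z≤n , s≤s z≤n) (x⊗-support f _))
        (+-identityʳ _)

xGeom : Series
xGeom = monoS x ⊗ geomS tzx

xGeom-x^suc : ∀ n a b c r → xGeom n a b c (suc r) ≡ monoS (mono n 0 0 n n) n a b c r
xGeom-x^suc n a b c r = trans (x⊗≡xShift (geomS tzx) n a b c (suc r)) (geomS-tzx n a b c r)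

xGeom-support : ∀ i j k l m → xGeom i j k l m ≢ 0 → mono i j k l m ≡ mono i 0 0 i (suc i)
xGeom-support i j k l zero    nonzero = ⊥-elim (nonzero (x⊗≡xShift (geomS tzx) i j k l 0))
xGeom-support i j k l (suc m) nonzero
  with refl ← monoS-support (mono i 0 0 i i) (mono i j k l m)
                            (subst (_≢ 0) (xGeom-x^suc i j k l m) nonzero)
  = refl

xGeom-diagonal : ∀ s → xGeom s 0 0 s (suc s) ≡ 1
xGeom-diagonal s = trans (xGeom-x^suc s 0 0 s s) (monoS-at-self (mono s 0 0 s s))

G1-x-free : ∀ p n a b c r → G1 p n a b c r ≢ 0 → r ≡ 0
G1-x-free p n a b c zero    _       = refl
G1-x-free p n a b c (suc r) nonzero = ⊥-elim (nonzero refl)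

xGeom⊗G1-support : ∀ p n a b c r i j k l m → m ≤ r →
  convolutionTerm xGeom (G1 p) (mono n a b c r) i j k l m ≢ 0 →
  mono i j k l m ≡ mono i 0 0 i (suc i) × m ≡ r
xGeom⊗G1-support p n a b c r i j k l m m≤r nonzero =
  xGeom-support i j k l m (proj₁ factors≢0) ,
  ≤-antisym m≤r (m∸n≡0⇒m≤n (G1-x-free p (n ∸ i) (a ∸ j) (b ∸ k) (c ∸ l) (r ∸ m) (proj₂ factors≢0)))
  where
  factors≢0 = m*n≢0⇒m≢0×n≢0 (xGeom i j k l m) _ nonzero

xGeom⊗G1-x⁰ : ∀ p n a b c → (xGeom ⊗ G1 p) n a b c 0 ≡ 0
xGeom⊗G1-x⁰ p n a b c =
  boxSum-zero (mono n a b c 0) (convolutionTerm xGeom (G1 p) (mono n a b c 0))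
    λ { (mono i j k l m) (_ , _ , _ , _ , m≤0) nonzero →
          case xGeom⊗G1-support p n a b c 0 i j k l m m≤0 nonzero of λ { (refl , ()) } }

xGeom⊗G1-x^suc-support : ∀ p n a b c s q → q ≼ mono n a b c (suc s) →
  convolutionTerm xGeom (G1 p) (mono n a b c (suc s)) at q ≢ 0 → q ≡ mono s 0 0 s (suc s)
xGeom⊗G1-x^suc-support p n a b c s (mono i j k l m) (_ , _ , _ , _ , m≤) nonzero
  with refl , refl ← xGeom⊗G1-support p n a b c (suc s) i j k l m m≤ nonzero = refl

xGeom⊗G1-x^suc : ∀ p n a b c s →
  (xGeom ⊗ G1 p) n a b c (suc s) ≡
  (if (s ≤ᵇ n) ∧ (s ≤ᵇ c) then G1 p (n ∸ s) a b (c ∸ s) 0 else 0)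
xGeom⊗G1-x^suc p n a b c s
  with s ≤ᵇ n | ≤ᵇ-reflects-≤ s n | s ≤ᵇ c | ≤ᵇ-reflects-≤ s c
... | true  | ofʸ s≤n | true  | ofʸ s≤c =
  trans (boxSum-single _ F q₀ (s≤n , z≤n , z≤n , s≤c , ≤-refl) (xGeom⊗G1-x^suc-support p n a b c s))
        (trans (cong₂ _*_ (xGeom-diagonal s) (cong (G1 p (n ∸ s) a b (c ∸ s)) (n∸n≡0 s)))
               (*-identityˡ _))
  where
  F  = convolutionTerm xGeom (G1 p) (mono n a b c (suc s))
  q₀ = mono s 0 0 s (suc s)
... | false | ofⁿ s≰n | _     | _        =
  boxSum-outside _ _ (mono s 0 0 s (suc s)) (s≰n ∘ proj₁) (xGeom⊗G1-x^suc-support p n a b c s)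
... | true  | _        | false | ofⁿ s≰c  =
  boxSum-outside _ _ (mono s 0 0 s (suc s)) (s≰c ∘ proj₁ ∘ proj₂ ∘ proj₂ ∘ proj₂)
                 (xGeom⊗G1-x^suc-support p n a b c s)

module _ (p : ℕ) where

  -- validFrom k prev w: w may follow a prefix that has k ascents and ends with prev.
  validFrom : ℕ → ℕ → List ℕ → Bool
  validFrom k prev []       = true
  validFrom k prev (y ∷ ys) = (y ≤ᵇ p + k) ∧ validFrom (k + toℕ (prev <ᵇ y)) y ys

  valid : List ℕ → Bool
  valid []      = true
  valid (y ∷ w) = (y ≡ᵇ 0) ∧ validFrom 0 y w

  validFrom-∷ʳ : ∀ k prev xs y →
    validFrom k prev (xs ++ [ y ]) ≡ validFrom k prev xs ∧ (y ≤ᵇ p + (k + asc (prev ∷ xs)))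
  validFrom-∷ʳ k prev []       y rewrite +-identityʳ k = ∧-identityʳ _
  validFrom-∷ʳ k prev (z ∷ zs) y
    rewrite validFrom-∷ʳ (k + toℕ (prev <ᵇ z)) z zs y
          | +-assoc k (toℕ (prev <ᵇ z)) (asc (z ∷ zs))
    = sym (∧-assoc (z ≤ᵇ p + k) _ _)

  valid-∷ʳ : ∀ y₀ xs y →
    valid (y₀ ∷ xs ++ [ y ]) ≡ valid (y₀ ∷ xs) ∧ (y ≤ᵇ p + asc (y₀ ∷ xs))
  valid-∷ʳ y₀ xs y rewrite validFrom-∷ʳ 0 y₀ xs y = sym (∧-assoc (y₀ ≡ᵇ 0) _ _)

  valid-∷ʳ-∷ʳ : ∀ ws z y →
    valid ((ws ++ [ z ]) ++ [ y ]) ≡ valid (ws ++ [ z ]) ∧ (y ≤ᵇ p + asc (ws ++ [ z ]))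
  valid-∷ʳ-∷ʳ []       z y = valid-∷ʳ z [] y
  valid-∷ʳ-∷ʳ (w ∷ ws) z y = valid-∷ʳ w (ws ++ [ z ]) y

  validRev≡valid∘reverse : ∀ u → validRev p u ≡ valid (reverse u)
  validRev≡valid∘reverse []          = refl
  validRev≡valid∘reverse (y ∷ [])    = sym (∧-identityʳ _)
  validRev≡valid∘reverse (y ∷ z ∷ r)
    rewrite validRev≡valid∘reverse (z ∷ r) | unfold-reverse y (z ∷ r) | unfold-reverse z r
    = sym (valid-∷ʳ-∷ʳ (reverse r) z y)

  isPAscent≡valid : ∀ w → isPAscent p w ≡ valid w
  isPAscent≡valid w =
    trans (validRev≡valid∘reverse (reverse w)) (cong valid (reverse-involutive w))

  validFrom-∷-≤ : ∀ {k y} prev w → y ≤ p + k →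
    validFrom k prev (y ∷ w) ≡ validFrom (k + toℕ (prev <ᵇ y)) y w
  validFrom-∷-≤ {k} {y} prev w y≤ with y ≤ᵇ p + k | ≤ᵇ-reflects-≤ y (p + k)
  ... | true  | _      = refl
  ... | false | ofⁿ y≰ = ⊥-elim (y≰ y≤)

  validFrom-∷-> : ∀ {k y} prev w → p + k < y → validFrom k prev (y ∷ w) ≡ false
  validFrom-∷-> {k} {y} prev w y> with y ≤ᵇ p + k | ≤ᵇ-reflects-≤ y (p + k)
  ... | true  | ofʸ y≤ = ⊥-elim (<⇒≱ y> y≤)
  ... | false | _      = refl

  count-validFrom-alphabet-independent : ∀ m k prev {N N′} (Q : List ℕ → Bool) →
    p + (k + m) ≤ N → p + (k + m) ≤ N′ →
    count (λ w → validFrom k prev w ∧ Q w) (words m (suc N)) ≡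
    count (λ w → validFrom k prev w ∧ Q w) (words m (suc N′))
  count-validFrom-alphabet-independent zero    k prev Q _     _      = refl
  count-validFrom-alphabet-independent (suc m) k prev {N} {N′} Q bound bound′ =
    trans (byFirstLetter bound) (trans (sumTo-cong same) (sym (byFirstLetter bound′)))
    where
    fromFirst : ℕ → ℕ → ℕ
    fromFirst M y = count (λ w → validFrom k prev (y ∷ w) ∧ Q (y ∷ w)) (words m (suc M))

    byFirstLetter : ∀ {M} → p + (k + suc m) ≤ M →
      count (λ w → validFrom k prev w ∧ Q w) (words (suc m) (suc M)) ≡
      sumTo (p + k) (fromFirst M)
    byFirstLetter {M} bnd =
      trans (count-words-suc _ m M)
            (sumTo-trunc (≤-trans (+-monoʳ-≤ p (m≤m+n k (suc m))) bnd) λ y y> _ →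
               count-zero (words m (suc M)) λ w → cong (_∧ Q (y ∷ w)) (validFrom-∷-> prev w y>))

    same : ∀ y → y ≤ p + k → fromFirst N y ≡ fromFirst N′ y
    same y y≤ = begin
      fromFirst N y
        ≡⟨ count-cong (words m (suc N)) drop-check ⟩
      count (λ w → validFrom k′ y w ∧ Q (y ∷ w)) (words m (suc N))
        ≡⟨ count-validFrom-alphabet-independent m k′ y (λ w → Q (y ∷ w))
             (≤-trans step bound) (≤-trans step bound′) ⟩
      count (λ w → validFrom k′ y w ∧ Q (y ∷ w)) (words m (suc N′))
        ≡⟨ count-cong (words m (suc N′)) drop-check ⟨
      fromFirst N′ y
        ∎
      where
      open ≡-Reasoning
      k′ = k + toℕ (prev <ᵇ y)
      drop-check : ∀ w → validFrom k prev (y ∷ w) ∧ Q (y ∷ w) ≡ validFrom k′ y w ∧ Q (y ∷ w)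
      drop-check w = cong (_∧ Q (y ∷ w)) (validFrom-∷-≤ prev w y≤)
      step : p + (k′ + m) ≤ p + (k + suc m)
      step = +-monoʳ-≤ p (≤-trans (+-monoˡ-≤ m (+-monoʳ-≤ k (toℕ≤1 (prev <ᵇ y))))
                                  (≤-reflexive (+-assoc k 1 m)))

  count-valid-alphabet-independent : ∀ m {N N′} (Q : List ℕ → Bool) →
    p + m ≤ N → p + m ≤ N′ →
    count (λ w → valid w ∧ Q w) (words m (suc N)) ≡ count (λ w → valid w ∧ Q w) (words m (suc N′))
  count-valid-alphabet-independent zero    Q _ _ = refl
  count-valid-alphabet-independent (suc m) {N} {N′} Q bound bound′ =
    trans (count-words-suc-0∷ _ m N λ _ _ → refl)
    (trans (count-validFrom-alphabet-independent m 0 0 (λ w → Q (0 ∷ w))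
              (≤-trans p+m≤ bound) (≤-trans p+m≤ bound′))
           (sym (count-words-suc-0∷ _ m N′ λ _ _ → refl)))
    where
    p+m≤ : p + m ≤ p + suc m
    p+m≤ = +-monoʳ-≤ p (n≤1+n m)

  -- The run is tested first and the number of zeros before the other statistics, so that
  -- most cases of the lemmas validWith-0∷-… below evaluate to false on their own.
  validWith : ℕ → ℕ → ℕ → ℕ → List ℕ → Bool
  validWith a b c r w =
    (run w ≡ᵇ r) ∧ valid w ∧ (zeros w ≡ᵇ c) ∧ (asc w ≡ᵇ a) ∧ (lastL w ≡ᵇ b)

  countValid : ℕ → ℕ → ℕ → ℕ → ℕ → ℕ → ℕ
  countValid N n a b c r = count (validWith a b c r) (words n (suc N))

  G≡countValid : ∀ n a b c r → G p n a b c r ≡ countValid (p + n) n a b c r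
  G≡countValid n a b c r =
    trans (count-filterᵇ _ (isPAscent p) (words n (suc (p + n))))
          (count-cong (words n (suc (p + n))) reorder)
    where
    reorder : ∀ w → isPAscent p w ∧ (asc w ≡ᵇ a) ∧ (lastL w ≡ᵇ b) ∧ (zeros w ≡ᵇ c) ∧ (run w ≡ᵇ r)
                    ≡ validWith a b c r w
    reorder w rewrite isPAscent≡valid w =
      ∧-shuffle₅ (valid w) (asc w ≡ᵇ a) (lastL w ≡ᵇ b) (zeros w ≡ᵇ c) (run w ≡ᵇ r)

  run≡ᵇ1 : ∀ w → (run w ≡ᵇ 1) ≡ startsOneZero w
  run≡ᵇ1 []                 = refl
  run≡ᵇ1 (suc _ ∷ _)        = refl
  run≡ᵇ1 (zero ∷ [])        = refl
  run≡ᵇ1 (zero ∷ suc _ ∷ _) = refl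
  run≡ᵇ1 (zero ∷ zero ∷ v) with allZero v
  ... | true  = refl
  ... | false = refl

  countValid≡G1 : ∀ {m n} a b c → m ≤ n → countValid (p + n) m a b c 1 ≡ G1 p m a b c 0
  countValid≡G1 {m} {n} a b c m≤n = begin
    count (validWith a b c 1) (words m (suc (p + n)))
      ≡⟨ count-cong (words m (suc (p + n))) reorder ⟩
    count (λ w → valid w ∧ stats w) (words m (suc (p + n)))
      ≡⟨ count-valid-alphabet-independent m stats (+-monoʳ-≤ p m≤n) ≤-refl ⟩
    count (λ w → valid w ∧ stats w) (words m (suc (p + m)))
      ≡⟨ count-cong (words m (suc (p + m))) (λ w → cong (_∧ stats w) (isPAscent≡valid w)) ⟨
    count (λ w → isPAscent p w ∧ stats w) (words m (suc (p + m)))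
      ≡⟨ count-filterᵇ stats (isPAscent p) (words m (suc (p + m))) ⟨
    G1 p m a b c 0
      ∎
    where
    open ≡-Reasoning
    stats : List ℕ → Bool
    stats w = startsOneZero w ∧ (asc w ≡ᵇ a) ∧ (lastL w ≡ᵇ b) ∧ (zeros w ≡ᵇ c)
    reorder : ∀ w → validWith a b c 1 w ≡ valid w ∧ stats w
    reorder w rewrite run≡ᵇ1 w =
      ∧-shuffle₅′ (startsOneZero w) (valid w) (zeros w ≡ᵇ c) (asc w ≡ᵇ a) (lastL w ≡ᵇ b)

  validWith-0∷-run≡0 : ∀ a b c w → validWith a b (suc c) 0 (0 ∷ w) ≡ validWith a b c 0 w
  validWith-0∷-run≡0 a b c []          = refl
  validWith-0∷-run≡0 a b c (suc _ ∷ _) = refl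
  validWith-0∷-run≡0 a b c (zero ∷ v) with allZero v
  ... | true  = refl
  ... | false = refl

  validWith-0∷-run≥2 : ∀ a b c s w →
    validWith a b (suc c) (2 + s) (0 ∷ w) ≡ validWith a b c (suc s) w
  validWith-0∷-run≥2 a b c s []          = refl
  validWith-0∷-run≥2 a b c s (suc _ ∷ _) = refl
  validWith-0∷-run≥2 a b c s (zero ∷ v) with allZero v
  ... | true  = refl
  ... | false = refl

  validWith-0∷-no-zeros : ∀ a b r w → validWith a b 0 r (0 ∷ w) ≡ false
  validWith-0∷-no-zeros a b r w rewrite ∧-zeroʳ (validFrom 0 0 w) = ∧-zeroʳ (run (0 ∷ w) ≡ᵇ r)

  countValid-x⁰ : ∀ N n a b c → countValid N n a b c 0 ≡ toℕ ((n ≡ᵇ c) ∧ (0 ≡ᵇ a) ∧ (0 ≡ᵇ b))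
  countValid-x⁰ N zero    a b c       = count-singleton (validWith a b c 0) []
  countValid-x⁰ N (suc n) a b zero    =
    trans (count-words-suc-0∷ _ n N λ _ _ → refl)
          (count-zero (words n (suc N)) (validWith-0∷-no-zeros a b 0))
  countValid-x⁰ N (suc n) a b (suc c) =
    trans (count-words-suc-0∷ _ n N λ _ _ → refl)
          (trans (count-cong (words n (suc N)) (validWith-0∷-run≡0 a b c))
                 (countValid-x⁰ N n a b c))

  countValid-x^suc : ∀ N n a b c s →
    countValid N n a b c (suc s) ≡
    (if (s ≤ᵇ n) ∧ (s ≤ᵇ c) then countValid N (n ∸ s) a b (c ∸ s) 1 else 0)
  countValid-x^suc N n       a b c       zero    = refl
  countValid-x^suc N zero    a b c       (suc s) = refl
  countValid-x^suc N (suc n) a b zero    (suc s) rewrite ∧-zeroʳ (suc s ≤ᵇ suc n) =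
    trans (count-words-suc-0∷ _ n N λ _ _ → refl)
          (count-zero (words n (suc N)) (validWith-0∷-no-zeros a b (2 + s)))
  countValid-x^suc N (suc n) a b (suc c) (suc s) rewrite ≤ᵇ-suc s n | ≤ᵇ-suc s c =
    trans (count-words-suc-0∷ _ n N λ _ _ → refl)
          (trans (count-cong (words n (suc N)) (validWith-0∷-run≥2 a b c s))
                 (countValid-x^suc N n a b c s))

theorem2p4 : (p : ℕ) → 1 ≤ p → (n a b c r : ℕ) →
    G p n a b c r ≡ (geomS tz ⊕ monoS x ⊗ geomS tzx ⊗ G1 p) n a b c r
theorem2p4 p _ n a b c zero = begin
  G p n a b c 0                              ≡⟨ G≡countValid p n a b c 0 ⟩
  countValid p (p + n) n a b c 0             ≡⟨ countValid-x⁰ p (p + n) n a b c ⟩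
  toℕ ((n ≡ᵇ c) ∧ (0 ≡ᵇ a) ∧ (0 ≡ᵇ b))       ≡⟨ geomS-tz-x⁰ n a b c ⟨
  geomS tz n a b c 0                         ≡⟨ +-identityʳ _ ⟨
  geomS tz n a b c 0 + 0                     ≡⟨ cong (geomS tz n a b c 0 +_) (xGeom⊗G1-x⁰ p n a b c) ⟨
  (geomS tz ⊕ xGeom ⊗ G1 p) n a b c 0        ∎
  where open ≡-Reasoning
theorem2p4 p _ n a b c (suc s) = begin
  G p n a b c (suc s)                        ≡⟨ G≡countValid p n a b c (suc s) ⟩
  countValid p (p + n) n a b c (suc s)       ≡⟨ countValid-x^suc p (p + n) n a b c s ⟩
  (if s-fits then countValid p (p + n) (n ∸ s) a b (c ∸ s) 1 else 0)
    ≡⟨ cong (λ t → if s-fits then t else 0) (countValid≡G1 p a b (c ∸ s) (m∸n≤m n s)) ⟩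
  (if s-fits then G1 p (n ∸ s) a b (c ∸ s) 0 else 0)
    ≡⟨ xGeom⊗G1-x^suc p n a b c s ⟨
  (xGeom ⊗ G1 p) n a b c (suc s)
    ≡⟨ cong (_+ (xGeom ⊗ G1 p) n a b c (suc s)) (geomS-tz-x^suc n a b c s) ⟨
  (geomS tz ⊕ xGeom ⊗ G1 p) n a b c (suc s)  ∎
  where
  open ≡-Reasoning
  s-fits = (s ≤ᵇ n) ∧ (s ≤ᵇ c)
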